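{- Let $m$ be a positive integer, $p$ a prime divisor of $m$, and write $m=p^k n$ with $p\nmid n$. Let $(b_1,\dots,b_m)$ be a sequence of elements of $\mathbb{Z}_m$ some cyclic translate $(b_i,b_{i+1},\dots,b_m,b_1,\dots,b_{i-1})$ of which is separable relative to $p$. Partition the sequence into $t\ge 3$ blocks $T_1,\dots,T_t$ of consecutive terms. If for some integer $1\le l\le k$ a residue $r$ modulo $p^l$ occurs (among the residues modulo $p^l$ of the elements) in every block $T_1,\dots,T_t$, then at most two of the blocks contain an element whose residue modulo $p^l$ differs from $r$. The same conclusion holds if, after forming the blocks, the elements are rearranged arbitrarily inside the individual blocks.
   Context: A sequence $(c_1,\dots,c_m)$ in $\mathbb{Z}_m$ is called separable relative to $p$ (where $m=p^kn$, $p\nmid n$) if for every $1\le l\le k$ and all $1\le i<h<j\le m$, $c_i\equiv c_j \pmod{p^l}$ implies $c_h\equiv c_i\pmod{p^l}$; i.e. elements equivalent modulo $p^l$ are consecutive, for every $l\le k$. -}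

module Defs where

open import Data.Nat using (ℕ; _+_; _^_; _≤_; _<_; NonZero)
open import Data.Nat.DivMod using (_mod_)
open import Data.Fin using (Fin; toℕ)
import Data.Fin as F
open import Data.Integer using (ℤ; +_; _-_)
open import Data.Integer.Divisibility using (_∣_)
open import Data.List using (List)
open import Data.List.Membership.Propositional using (_∈_)
open import Data.Product using (∃; _×_)
open import Relation.Binary.PropositionalEquality using (_≢_)
open import Relation.Nullary using (¬_)

_≡_[mod_] : ℕ → ℕ → ℕ → Set
x ≡ y [mod q ] = (+ q) ∣ ((+ x) - (+ y))

Separable : (p k m : ℕ) → (Fin m → Fin m) → Set
Separable p k m c =
  ∀ (l : ℕ) → 1 ≤ l → l ≤ k →
  ∀ (i h j : Fin m) → i F.< h → h F.< j →
  toℕ (c i) ≡ toℕ (c j) [mod p ^ l ] →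
  toℕ (c h) ≡ toℕ (c i) [mod p ^ l ]

translate : (m : ℕ) .{{_ : NonZero m}} → (Fin m → Fin m) → Fin m → (Fin m → Fin m)
translate m b i j = b ((toℕ i + toℕ j) mod m)

Occurs : {m : ℕ} → ℕ → ℕ → List (Fin m) → Set
Occurs q r B = ∃ λ x → x ∈ B × toℕ x ≡ r [mod q ]

Deviates : {m : ℕ} → ℕ → ℕ → List (Fin m) → Set
Deviates q r B = ∃ λ x → x ∈ B × ¬ (toℕ x ≡ r [mod q ])

-- Reading positions cyclically from the start i of the separable translate,
-- the positions whose entry has residue r modulo p^l form a cyclic interval. So if x and z
-- carry residue r, one of the two arcs cut out by x and z carries residue r throughout.
-- With t₁ < t₂ < t₃ three blocks each containing a position aⱼ with residue r and a position
-- dⱼ without it, one of the pairs (a₁, a₃) and (a₁, a₂) has deviating positions on both of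
-- its arcs: d₂ inside and d₁ outside the first if d₁ < a₁, else d₁ inside and d₃ outside
-- the second. Permuting inside the blocks changes neither occurrence nor deviation.
module Submission where

open import Defs
open import Data.Nat using (ℕ; _*_; _^_; _≤_; NonZero)
open import Data.Nat.Primality using (Prime)
import Data.Nat.Divisibility as ND
open import Data.Fin using (Fin)
import Data.Fin as F
open import Data.List using (List; concat; tabulate; length; lookup)
open import Data.List.Relation.Binary.Pointwise using (Pointwise)
open import Data.List.Relation.Binary.Permutation.Propositional using (_↭_)
open import Data.Product using (∃; _×_)
open import Relation.Binary.PropositionalEquality using (_≡_)
open import Relation.Nullary using (¬_)

open import Data.Nat using (suc; _+_; _∸_; _%_; _<_; _<?_; _≤?_; z≤n; s≤s; z<s)
open import Data.Nat.Properties
open import Data.Nat.DivMod using (_mod_; m<n⇒m%n≡m; [m+n]%n≡m%n)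
open import Data.Fin using (toℕ; fromℕ<)
open import Data.Fin.Properties using (toℕ-injective; toℕ-fromℕ<; toℕ<n; toℕ-cast)
open import Data.List using ([]; _∷_; _++_; map; take)
open import Data.Nat.ListAction using (sum)
open import Data.List.Properties using (∷-injectiveˡ; ∷-injectiveʳ; ++-assoc; length-++)
open import Data.List.Membership.Propositional using (_∈_)
open import Data.List.Membership.Propositional.Properties using (∈-∃++)
open import Data.List.Relation.Binary.Pointwise using (lookup⁺; symmetric; Pointwise-length)
open import Data.List.Relation.Binary.Permutation.Propositional using (↭-sym)
open import Data.List.Relation.Binary.Permutation.Propositional.Properties using (∈-resp-↭)
open import Data.Product using (_,_; ∃₂)
open import Data.Sum using (_⊎_; inj₁; inj₂; [_,_])
open import Data.Empty using (⊥)
open import Function using (_∘_)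
open import Relation.Nullary using (yes; no; contradiction)
open import Relation.Binary.PropositionalEquality using (refl; sym; trans; cong; subst; subst₂)
import Data.Integer as ℤ
open import Data.Integer.Divisibility using (_∣_)
open import Data.Integer.Divisibility.Signed using (∣m∣n⇒∣m+n; ∣ᵤ⇒∣; ∣⇒∣ᵤ)
open import Data.Integer.Properties using (∣i-j∣≡∣j-i∣; +-minus-telescope)

≡-mod-sym : ∀ {q} x y → x ≡ y [mod q ] → y ≡ x [mod q ]
≡-mod-sym {q} x y = subst (q ND.∣_) (∣i-j∣≡∣j-i∣ (ℤ.+ x) (ℤ.+ y))

≡-mod-trans : ∀ {q} x y z → x ≡ y [mod q ] → y ≡ z [mod q ] → x ≡ z [mod q ]
≡-mod-trans {q} x y z x≡y y≡z = subst ((ℤ.+ q) ∣_) (+-minus-telescope (ℤ.+ x) (ℤ.+ y) (ℤ.+ z))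
  (∣⇒∣ᵤ (∣m∣n⇒∣m+n (∣ᵤ⇒∣ {ℤ.+ q} {ℤ.+ x ℤ.- ℤ.+ y} x≡y) (∣ᵤ⇒∣ {ℤ.+ q} {ℤ.+ y ℤ.- ℤ.+ z} y≡z)))

module CyclicOrder {m : ℕ} (i : Fin m) where

  data _≺_ (u v : Fin m) : Set where
    above : i F.≤ u → u F.< v → u ≺ v
    below : v F.< i → u F.< v → u ≺ v
    wraps : v F.< i → i F.≤ u → u ≺ v

  CyclicallyConvex : (Fin m → Set) → Set
  CyclicallyConvex P = ∀ {x y z} → x ≺ y → y ≺ z → P x → P z → P y

  arc : ∀ {P x z} → CyclicallyConvex P → x F.< z → P x → P z →
        (∀ y → x F.< y → y F.< z → P y) ⊎ (∀ w → w F.< x ⊎ z F.< w → P w)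
  arc {P} {x} {z} convex x<z Px Pz with toℕ i ≤? toℕ x | toℕ z <? toℕ i
  ... | yes i≤x | _ = inj₁ λ y x<y y<z →
    convex (above i≤x x<y) (above (≤-trans i≤x (<⇒≤ x<y)) y<z) Px Pz
  ... | no _ | yes z<i = inj₁ λ y x<y y<z →
    convex (below (<-trans y<z z<i) x<y) (below z<i y<z) Px Pz
  ... | no i≰x | no z≮i = inj₂ outer
    where
    x<i : x F.< i
    x<i = ≰⇒> i≰x
    i≤z : i F.≤ z
    i≤z = ≮⇒≥ z≮i
    outer : ∀ w → w F.< x ⊎ z F.< w → P w
    outer w (inj₁ w<x) = convex (wraps (<-trans w<x x<i) i≤z) (below x<i w<x) Pz Px
    outer w (inj₂ z<w) = convex (above i≤z z<w) (wraps x<i (≤-trans i≤z (<⇒≤ z<w))) Pz Px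

ConsecutiveClasses : ∀ {m} → ℕ → (Fin m → Fin m) → Set
ConsecutiveClasses q c = ∀ x h y → x F.< h → h F.< y →
  toℕ (c x) ≡ toℕ (c y) [mod q ] → toℕ (c h) ≡ toℕ (c x) [mod q ]

module Rotation {m : ℕ} .{{_ : NonZero m}} (b : Fin m → Fin m) (i : Fin m) where
  open CyclicOrder i

  -- The index of u in the translate starting at i, shifted by i and not yet reduced modulo m.
  unroll : Fin m → ℕ
  unroll u with toℕ u <? toℕ i
  ... | yes _ = toℕ u + m
  ... | no _ = toℕ u

  unroll-below : ∀ {u} → u F.< i → unroll u ≡ toℕ u + m
  unroll-below {u} u<i with toℕ u <? toℕ i
  ... | yes _ = refl
  ... | no u≮i = contradiction u<i u≮i

  unroll-above : ∀ {u} → i F.≤ u → unroll u ≡ toℕ u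
  unroll-above {u} i≤u with toℕ u <? toℕ i
  ... | yes u<i = contradiction i≤u (<⇒≱ u<i)
  ... | no _ = refl

  i≤unroll : ∀ u → toℕ i ≤ unroll u
  i≤unroll u with toℕ u <? toℕ i
  ... | yes _ = ≤-trans (<⇒≤ (toℕ<n i)) (m≤n+m m (toℕ u))
  ... | no u≮i = ≮⇒≥ u≮i

  unroll<i+m : ∀ u → unroll u < toℕ i + m
  unroll<i+m u with toℕ u <? toℕ i
  ... | yes u<i = +-monoˡ-< m u<i
  ... | no _ = <-≤-trans (toℕ<n u) (m≤n+m m (toℕ i))

  unroll%m : ∀ u → unroll u % m ≡ toℕ u
  unroll%m u with toℕ u <? toℕ i
  ... | yes _ = trans ([m+n]%n≡m%n (toℕ u) m) (m<n⇒m%n≡m (toℕ<n u))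
  ... | no _ = m<n⇒m%n≡m (toℕ<n u)

  ≺⇒unroll-< : ∀ {u v} → u ≺ v → unroll u < unroll v
  ≺⇒unroll-< (above i≤u u<v)
    rewrite unroll-above i≤u | unroll-above (≤-trans i≤u (<⇒≤ u<v)) = u<v
  ≺⇒unroll-< (below v<i u<v)
    rewrite unroll-below (<-trans u<v v<i) | unroll-below v<i = +-monoˡ-< m u<v
  ≺⇒unroll-< {u} {v} (wraps v<i i≤u)
    rewrite unroll-above i≤u | unroll-below v<i = <-≤-trans (toℕ<n u) (m≤n+m m (toℕ v))

  rotate : ∀ u → ∃ λ j → translate m b i j ≡ b u × toℕ i + toℕ j ≡ unroll u
  rotate u = j , cong b (toℕ-injective toℕ[i+j%m]≡u) , i+j≡unroll
    where
    j<m : unroll u ∸ toℕ i < m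
    j<m = subst (unroll u ∸ toℕ i <_) (m+n∸m≡n (toℕ i) m) (∸-monoˡ-< (unroll<i+m u) (i≤unroll u))
    j : Fin m
    j = fromℕ< j<m
    i+j≡unroll : toℕ i + toℕ j ≡ unroll u
    i+j≡unroll = trans (cong (toℕ i +_) (toℕ-fromℕ< j<m)) (m+[n∸m]≡n (i≤unroll u))
    toℕ[i+j%m]≡u : toℕ ((toℕ i + toℕ j) mod m) ≡ toℕ u
    toℕ[i+j%m]≡u = trans (toℕ-fromℕ< _) (trans (cong (_% m) i+j≡unroll) (unroll%m u))

  consecutive⇒convex : ∀ {q} → ConsecutiveClasses q (translate m b i) →
                       ∀ r → CyclicallyConvex (λ u → toℕ (b u) ≡ r [mod q ])
  consecutive⇒convex {q} consecutive r {x} {y} {z} x≺y y≺z bx≡r bz≡r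
    with rotate x | rotate y | rotate z
  ... | jx , cjx≡bx , ex | jy , cjy≡by , ey | jz , cjz≡bz , ez =
    ≡-mod-trans (toℕ (b y)) (toℕ (b x)) r by≡bx bx≡r
    where
    rotated-< : ∀ {u v ju jv} → toℕ i + toℕ ju ≡ unroll u → toℕ i + toℕ jv ≡ unroll v →
                u ≺ v → ju F.< jv
    rotated-< eu ev u≺v = +-cancelˡ-< (toℕ i) _ _ (subst₂ _<_ (sym eu) (sym ev) (≺⇒unroll-< u≺v))
    _≈_ : Fin m → Fin m → Set
    c ≈ c' = toℕ c ≡ toℕ c' [mod q ]
    by≡bx : b y ≈ b x
    by≡bx = subst₂ _≈_ cjy≡by cjx≡bx
      (consecutive jx jy jz (rotated-< ex ey x≺y) (rotated-< ey ez y≺z)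
        (subst₂ _≈_ (sym cjx≡bx) (sym cjz≡bz)
          (≡-mod-trans (toℕ (b x)) r (toℕ (b z)) bx≡r (≡-mod-sym (toℕ (b z)) r bz≡r))))

module _ {A : Set} where

  offset : List (List A) → ℕ → ℕ
  offset Bs s = sum (map length (take s Bs))

  offset-mono : ∀ Bs {s s'} → s ≤ s' → offset Bs s ≤ offset Bs s'
  offset-mono Bs z≤n = z≤n
  offset-mono [] (s≤s _) = z≤n
  offset-mono (B ∷ Bs) (s≤s s≤s') = +-monoʳ-≤ (length B) (offset-mono Bs s≤s')

  InBlock : List (List A) → ℕ → ℕ → Set
  InBlock Bs t j = offset Bs t ≤ j × j < offset Bs (suc t)

  InBlock-< : ∀ Bs {t t' j j'} → t < t' → InBlock Bs t j → InBlock Bs t' j' → j < j'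
  InBlock-< Bs t<t' (_ , j<end) (start' , _) = <-≤-trans j<end (≤-trans (offset-mono Bs t<t') start')

  ∈-lookup⇒concat-split : ∀ (Bs : List (List A)) t {x} → x ∈ lookup Bs t →
    ∃₂ λ ys zs → concat Bs ≡ ys ++ x ∷ zs × InBlock Bs (toℕ t) (length ys)
  ∈-lookup⇒concat-split (B ∷ Bs) F.zero x∈B with ys , zs , refl ← ∈-∃++ x∈B =
    ys , zs ++ concat Bs , ++-assoc ys (_ ∷ zs) (concat Bs) , z≤n ,
    subst (length ys <_) (sym (trans (+-identityʳ _) (length-++ ys))) (m<m+n (length ys) z<s)
  ∈-lookup⇒concat-split (B ∷ Bs) (F.suc t) x∈
    with ys , zs , eq , start , end ← ∈-lookup⇒concat-split Bs t x∈ =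
    B ++ ys , zs , trans (cong (B ++_) eq) (sym (++-assoc B ys _)) ,
    subst (_ ≤_) (sym (length-++ B)) (+-monoʳ-≤ (length B) start) ,
    subst (_< _) (sym (length-++ B)) (+-monoʳ-< (length B) end)

  tabulate-split : ∀ {n} (f : Fin n → A) ys {x zs} → tabulate f ≡ ys ++ x ∷ zs →
                   ∃ λ u → toℕ u ≡ length ys × f u ≡ x
  tabulate-split {suc n} f [] eq = F.zero , refl , ∷-injectiveˡ eq
  tabulate-split {suc n} f (y ∷ ys) eq
    with u , u≡ , fu≡x ← tabulate-split (f ∘ F.suc) ys (∷-injectiveʳ eq) =
    F.suc u , cong suc u≡ , fu≡x

  locate : ∀ {n} {b : Fin n → A} Bs {R : A → Set} → concat Bs ≡ tabulate b → ∀ t →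
           (∃ λ x → x ∈ lookup Bs t × R x) → ∃ λ u → R (b u) × InBlock Bs (toℕ t) (toℕ u)
  locate {b = b} Bs {R} concat≡b t (x , x∈ , Rx)
    with ys , zs , split , inBlock ← ∈-lookup⇒concat-split Bs t x∈
    with u , u≡ys , bu≡x ← tabulate-split b ys (trans (sym concat≡b) split) =
    u , subst R (sym bu≡x) Rx , subst (InBlock Bs (toℕ t)) (sym u≡ys) inBlock

  Mixed : (A → Set) → List A → Set
  Mixed Q B = (∃ λ x → x ∈ B × Q x) × (∃ λ x → x ∈ B × ¬ Q x)

open CyclicOrder using (CyclicallyConvex; arc)

no-three-mixed-blocks : ∀ {m} {A : Set} {Q : A → Set} {b : Fin m → A}
  (i : Fin m) (Bs : List (List A)) →
  CyclicallyConvex i (Q ∘ b) → concat Bs ≡ tabulate b →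
  ∀ t₁ t₂ t₃ → t₁ F.< t₂ → t₂ F.< t₃ →
  Mixed Q (lookup Bs t₁) → Mixed Q (lookup Bs t₂) → Mixed Q (lookup Bs t₃) → ⊥
no-three-mixed-blocks {Q = Q} {b} i Bs convex concat≡b t₁ t₂ t₃ t₁<t₂ t₂<t₃
  (A₁ , D₁) (A₂ , D₂) (A₃ , D₃)
  with a₁ , Qa₁ , a₁∈ ← locate Bs concat≡b t₁ A₁
     | d₁ , ¬Qd₁ , d₁∈ ← locate Bs concat≡b t₁ D₁
     | a₂ , Qa₂ , a₂∈ ← locate Bs concat≡b t₂ A₂
     | d₂ , ¬Qd₂ , d₂∈ ← locate Bs concat≡b t₂ D₂
     | a₃ , Qa₃ , a₃∈ ← locate Bs concat≡b t₃ A₃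
     | d₃ , ¬Qd₃ , d₃∈ ← locate Bs concat≡b t₃ D₃
  with toℕ d₁ <? toℕ a₁
... | yes d₁<a₁ =
  [ (λ inner → ¬Qd₂ (inner d₂ (InBlock-< Bs t₁<t₂ a₁∈ d₂∈) (InBlock-< Bs t₂<t₃ d₂∈ a₃∈)))
  , (λ outer → ¬Qd₁ (outer d₁ (inj₁ d₁<a₁))) ]
  (arc i convex (InBlock-< Bs (<-trans t₁<t₂ t₂<t₃) a₁∈ a₃∈) Qa₁ Qa₃)
... | no d₁≮a₁ =
  [ (λ inner → ¬Qd₁ (inner d₁ a₁<d₁ (InBlock-< Bs t₁<t₂ d₁∈ a₂∈)))
  , (λ outer → ¬Qd₃ (outer d₃ (inj₂ (InBlock-< Bs t₂<t₃ a₂∈ d₃∈)))) ]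
  (arc i convex (InBlock-< Bs t₁<t₂ a₁∈ a₂∈) Qa₁ Qa₂)
  where
  a₁<d₁ : a₁ F.< d₁
  a₁<d₁ = ≤∧≢⇒< (≮⇒≥ d₁≮a₁) (λ a₁≡d₁ → ¬Qd₁ (subst (Q ∘ b) (toℕ-injective a₁≡d₁) Qa₁))

lemma2p5 : (m : ℕ) .{{_ : NonZero m}} (p k n : ℕ) → Prime p → p ND.∣ m → ¬ (p ND.∣ n) → m ≡ p ^ k * n →
    (b : Fin m → Fin m) → (∃ λ i → Separable p k m (translate m b i)) →
    (Bs : List (List (Fin m))) → concat Bs ≡ tabulate b → 3 ≤ length Bs →
    (l : ℕ) → 1 ≤ l → l ≤ k → (r : ℕ) →
    (∀ (s : Fin (length Bs)) → Occurs (p ^ l) r (lookup Bs s)) →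
    (Bs' : List (List (Fin m))) → Pointwise _↭_ Bs Bs' →
    ∀ (s₁ s₂ s₃ : Fin (length Bs')) → s₁ F.< s₂ → s₂ F.< s₃ →
    ¬ (Deviates (p ^ l) r (lookup Bs' s₁) × Deviates (p ^ l) r (lookup Bs' s₂) × Deviates (p ^ l) r (lookup Bs' s₃))
lemma2p5 m p k n _ _ _ _ b (i , separable) Bs concat≡b _ l 1≤l l≤k r occurs Bs' Bs↭Bs'
  s₁ s₂ s₃ s₁<s₂ s₂<s₃ (deviates₁ , deviates₂ , deviates₃) =
  no-three-mixed-blocks i Bs (Rotation.consecutive⇒convex b i (separable l 1≤l l≤k) r) concat≡b
    (block s₁) (block s₂) (block s₃) (block-< s₁<s₂) (block-< s₂<s₃)
    (mixed s₁ deviates₁) (mixed s₂ deviates₂) (mixed s₃ deviates₃)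
  where
  Bs'↭Bs : Pointwise _↭_ Bs' Bs
  Bs'↭Bs = symmetric ↭-sym Bs↭Bs'

  block : Fin (length Bs') → Fin (length Bs)
  block = F.cast (Pointwise-length Bs'↭Bs)

  block-< : ∀ {s s'} → s F.< s' → block s F.< block s'
  block-< {s} {s'} = subst₂ _<_ (sym (toℕ-cast _ s)) (sym (toℕ-cast _ s'))

  mixed : ∀ s → Deviates (p ^ l) r (lookup Bs' s) → Mixed (λ x → toℕ x ≡ r [mod p ^ l ]) (lookup Bs (block s))
  mixed s (x , x∈ , x≢r) = occurs (block s) , x , ∈-resp-↭ (lookup⁺ Bs'↭Bs s) x∈ , x≢r
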